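{- Let $G=(V,E)$ be a finite simple undirected graph with $n=|V|$ vertices and threshold function $t:V\to\mathbb{N}_0$, and consider any execution of Algorithm TSS on $(G,t)$. Let $1<i\le n$. If $S^{(i-1)}\subseteq V_{i-1}$ is a target set for the graph $G(i-1)$ with threshold function $u\mapsto k_{i-1}(u)$ ($u\in V_{i-1}$), then the set $$S^{(i)}=\begin{cases} S^{(i-1)}\cup\{v_i\} & \text{if } k_i(v_i)>\delta_i(v_i),\\ S^{(i-1)} & \text{otherwise}\end{cases}$$ is a target set for $G(i)$ with threshold function $u\mapsto k_i(u)$ ($u\in V_i$).
   Context: For a graph $H$ and vertex $v$, $\Gamma_H(v)$ is the neighborhood of $v$ in $H$ and $d_H(v)=|\Gamma_H(v)|$; $\Gamma(v),d(v)$ refer to $G$. $\mathbb{N}_0=\{0,1,2,\ldots\}$. Activation process: for a graph $H=(W,F)$ with thresholds $\tau:W\to\mathbb{N}_0$ and $S\subseteq W$, set $\mathrm{Active}_H[S,0]=S$ and for $\ell\ge1$, $\mathrm{Active}_H[S,\ell]=\mathrm{Active}_H[S,\ell-1]\cup\{u\in W: |\Gamma_H(u)\cap \mathrm{Active}_H[S,\ell-1]|\ge \tau(u)\}$. $S$ is a target set for $H$ (with thresholds $\tau$) if $\mathrm{Active}_H[S,\lambda]=W$ for some $\lambda\ge0$. Algorithm TSS on input $(G,t)$: set $S=\emptyset$, $U=V$, and for each $v\in V$ set $\delta(v)=d(v)$, $k(v)=t(v)$, $N(v)=\Gamma(v)$. While $U\neq\emptyset$: (Case 1) if some $v\in U$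 has $k(v)=0$, select such a $v$ and for each $u\in N(v)$ set $k(u)=\max(k(u)-1,0)$; (Case 2) otherwise, if some $v\in U$ has $\delta(v)<k(v)$, select such a $v$, set $S=S\cup\{v\}$, and for each $u\in N(v)$ set $k(u)=k(u)-1$; (Case 3) otherwise select $v\in\arg\max_{u\in U} \frac{k(u)}{\delta(u)(\delta(u)+1)}$. In every case, then, for each $u\in N(v)$ set $\delta(u)=\delta(u)-1$ and $N(u)=N(u)\setminus\{v\}$, and set $U=U\setminus\{v\}$. When $U=\emptyset$, output $S$. (When several vertices qualify for selection, the algorithm picks one of them; the choice rule is not specified.) Notation for an execution: $v_i$ denotes the vertex selected during the $(n-i+1)$-th iteration ($i=n,\ldots,1$); $V_i=\{v_i,\ldots,v_1\}$ and $G(i)$ is the subgraph of $G$ induced by $V_i$; $\delta_i(v)$, $N_i(v)$, $k_i(v)$ denote the values of $\delta(v)$, $N(v)$, $k(v)$ at the beginning of the $(n-i+1)$-th iteration. -}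

module Defs where

open import Data.Nat using (ℕ; zero; suc; _∸_; _*_; _≤_; _<_; _≤ᵇ_; _<ᵇ_)
open import Data.Bool using (Bool; true; false; if_then_else_; _∧_; _∨_)
open import Data.Fin using (Fin)
open import Data.Vec using (Vec; lookup; tabulate)
open import Data.Fin.Subset using (Subset; _∈_; _∪_; _∩_; _-_; ⁅_⁆; ∣_∣)
  renaming (⊥ to ∅; ⊤ to full)
open import Relation.Binary.PropositionalEquality using (_≡_; _≢_)
open import Relation.Nullary using (¬_)
open import Data.Product using (∃)

record Graph (n : ℕ) : Set where
  field
    adj    : Fin n → Fin n → Bool
    sym    : ∀ u v → adj u v ≡ adj v u
    irrefl : ∀ v → adj v v ≡ false

  Γ : Fin n → Subset n
  Γ v = tabulate (adj v)

  deg : Fin n → ℕ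
  deg v = ∣ Γ v ∣

open Graph public

-- Activation process on the induced subgraph H = G[W] with thresholds τ.

Active : ∀ {n} → Graph n → (W : Subset n) → (τ : Fin n → ℕ) → (S : Subset n) → ℕ → Subset n
Active G W τ S zero = S
Active G W τ S (suc ℓ) =
  let A = Active G W τ S ℓ in
  tabulate (λ u → lookup A u ∨ (lookup W u ∧ (τ u ≤ᵇ ∣ (Γ G u ∩ W) ∩ A ∣)))

IsTarget : ∀ {n} → Graph n → (W : Subset n) → (τ : Fin n → ℕ) → (S : Subset n) → Set
IsTarget G W τ S = ∃ λ λ′ → Active G W τ S λ′ ≡ W

record State (n : ℕ) : Set where
  field
    U : Subset n
    δ : Fin n → ℕ
    k : Fin n → ℕ
    N : Fin n → Subset n
    S : Subset n

open State public

initial : ∀ {n} → Graph n → (Fin n → ℕ) → State n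
initial G t = record { U = full ; δ = deg G ; k = t ; N = Γ G ; S = ∅ }

update : ∀ {n} → State n → Fin n → (Fin n → ℕ) → Subset n → State n
update s v k′ S′ = record
  { U = U s - v
  ; δ = λ u → if lookup (N s v) u then δ s u ∸ 1 else δ s u
  ; k = k′
  ; N = λ u → if lookup (N s v) u then N s u - v else N s u
  ; S = S′
  }

decK : ∀ {n} → State n → Fin n → Fin n → ℕ
decK s v u = if lookup (N s v) u then k s u ∸ 1 else k s u

data Step {n : ℕ} (s : State n) (v : Fin n) (s′ : State n) : Set where
  case1 : v ∈ U s → k s v ≡ 0 →
          s′ ≡ update s v (decK s v) (S s) → Step s v s′
  case2 : (∀ w → w ∈ U s → k s w ≢ 0) →
          v ∈ U s → δ s v < k s v →
          s′ ≡ update s v (decK s v) (S s ∪ ⁅ v ⁆) → Step s v s′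
  case3 : (∀ w → w ∈ U s → k s w ≢ 0) →
          (∀ w → w ∈ U s → ¬ (δ s w < k s w)) →
          v ∈ U s →
          -- v maximises k(u)/(δ(u)(δ(u)+1)) over U (denominators are
          -- positive in this case, so we cross-multiply)
          (∀ w → w ∈ U s → k s w * (δ s v * suc (δ s v)) ≤ k s v * (δ s w * suc (δ s w))) →
          s′ ≡ update s v (k s) (S s) → Step s v s′

-- An execution of TSS on (G, t): st j is the state at the beginning of
-- iteration j+1, sel j the vertex selected during iteration j+1.
record Execution {n : ℕ} (G : Graph n) (t : Fin n → ℕ) : Set where
  field
    st   : ℕ → State n
    sel  : ℕ → Fin n
    init : st 0 ≡ initial G t
    step : ∀ j → j < n → Step (st j) (sel j) (st (suc j))
    done : U (st n) ≡ ∅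

open Execution public

module _ {n : ℕ} {G : Graph n} {t : Fin n → ℕ} (E : Execution G t) where

  -- v_i : vertex selected during the (n-i+1)-th iteration
  vtx : ℕ → Fin n
  vtx i = sel E (n ∸ i)

  -- δ_i, N_i, k_i : values at the beginning of the (n-i+1)-th iteration
  δᵢ : ℕ → Fin n → ℕ
  δᵢ i = δ (st E (n ∸ i))

  Nᵢ : ℕ → Fin n → Subset n
  Nᵢ i = N (st E (n ∸ i))

  kᵢ : ℕ → Fin n → ℕ
  kᵢ i = k (st E (n ∸ i))

  Vᵢ : ℕ → Subset n
  Vᵢ zero = ∅
  Vᵢ (suc i) = ⁅ vtx (suc i) ⁆ ∪ Vᵢ i

  nextS : ℕ → Subset n → Subset n
  nextS i S′ = if δᵢ i (vtx i) <ᵇ kᵢ i (vtx i) then S′ ∪ ⁅ vtx i ⁆ else S′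

-- Let W be the set of unprocessed vertices when v is selected, so W - v
-- remains afterwards.  The heart of the proof is a simulation argument
-- (module Restriction): the activation process on G[W - v] with the
-- updated thresholds τ′ is dominated, round by round up to a fixed delay c,
-- by the process on G[W] with the old thresholds τ, as long as every
-- vertex x either keeps τ x ≤ τ′ x or is a neighbour of v, v is already
-- active by round c, and τ x ≤ τ′ x + 1.  Two consequences close the gap
-- left by v itself:
--   * extend-active (Cases 1 and 2): v is active by round c from the start;
--   * extend-last (Case 3): thresholds are unchanged, and v fires after
--     all of W - v because τ v is at most its degree in G[W].
-- The TSS bookkeeping is linked to the graph by the invariant Faithful
-- (N and δ are the neighbourhood and degree in the induced subgraph on U),
-- which every iteration preserves; together with U (st (n ∸ i)) ≡ V_i
-- this reduces lemma2 to the one-step statement step-back.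

module Submission where

open import Defs hiding (sym)
open import Data.Nat using (ℕ; _∸_; _<_; _≤_)
open import Data.Fin using (Fin)
open import Data.Fin.Subset using (Subset; _⊆_)

open import Data.Nat using (zero; suc; z≤n; s≤s; _+_; _<ᵇ_; _≤ᵇ_)
open import Data.Nat.Properties
  using ( ≤-refl; ≤-trans; <⇒≤; ≮⇒≥; n≮0; m∸n≤m; +-∸-assoc; m≤n+m∸n
        ; <⇒<ᵇ; <ᵇ⇒<; ≤⇒≤ᵇ; ≤ᵇ⇒≤ )
open import Data.Bool using (Bool; true; false; if_then_else_; _∨_; _∧_)
open import Data.Bool.Properties using (T-≡; ∨-zeroʳ)
open import Data.Fin using (zero; suc; _≟_)
open import Data.Vec using (_∷_; lookup; tabulate)
open import Data.Vec.Properties using (lookup∘tabulate; []=⇒lookup; lookup⇒[]=)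
open import Data.Fin.Subset using (_∈_; _∉_; _∩_; _∪_; _-_; ⁅_⁆; ∣_∣; outside; inside)
open import Data.Fin.Subset.Properties
  using ( p⊆q⇒∣p∣≤∣q∣; p⊂q⇒∣p∣<∣q∣; ⊆-antisym; x∈p∩q⁺; x∈p∩q⁻; p─q⊆p; x∈p∧x≢y⇒x∈p-y
        ; p─⊥≡p; drop-there; x∈⁅x⁆; x∈⁅y⁆⇒x≡y; x∈p∪q⁺; x∈p∪q⁻; ∩-identityʳ )
open import Data.Product using (_×_; _,_; proj₁; proj₂)
open import Data.Sum using (_⊎_; inj₁; inj₂)
import Data.Sum as Sum
open import Function using (_∘_; Equivalence)
open import Relation.Binary.PropositionalEquality
open import Relation.Nullary using (¬_; yes; no; contradiction)

∈-tabulate⁺ : ∀ {n} {f : Fin n → Bool} {x} → f x ≡ true → x ∈ tabulate f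
∈-tabulate⁺ {f = f} {x} fx = lookup⇒[]= x _ (trans (lookup∘tabulate f x) fx)

∈-tabulate⁻ : ∀ {n} {f : Fin n → Bool} {x} → x ∈ tabulate f → f x ≡ true
∈-tabulate⁻ {f = f} {x} x∈ = trans (sym (lookup∘tabulate f x)) ([]=⇒lookup x∈)

y∉p-y : ∀ {n} (p : Subset n) y → y ∉ p - y
y∉p-y (_ ∷ p) zero    ()
y∉p-y (_ ∷ p) (suc y) y∈ = y∉p-y p y (drop-there y∈)

x∈p-y⇒x≢y : ∀ {n} {p : Subset n} {x y} → x ∈ p - y → x ≢ y
x∈p-y⇒x≢y {p = p} {y = y} x∈ refl = y∉p-y p y x∈

∣p∣≡1+∣p-x∣ : ∀ {n} (p : Subset n) {x} → x ∈ p → ∣ p ∣ ≡ suc ∣ p - x ∣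
∣p∣≡1+∣p-x∣ (inside ∷ p)  {zero}  _  = cong (suc ∘ ∣_∣) (sym (p─⊥≡p p))
∣p∣≡1+∣p-x∣ (inside ∷ p)  {suc x} x∈ = cong suc (∣p∣≡1+∣p-x∣ p (drop-there x∈))
∣p∣≡1+∣p-x∣ (outside ∷ p) {suc x} x∈ = ∣p∣≡1+∣p-x∣ p (drop-there x∈)

∩-minus : ∀ {n} (p q : Subset n) y → p ∩ (q - y) ≡ (p ∩ q) - y
∩-minus p q y = ⊆-antisym forth back
  where
  forth : p ∩ (q - y) ⊆ (p ∩ q) - y
  forth x∈ with x∈p∩q⁻ p (q - y) x∈
  ... | x∈p , x∈q-y =
    x∈p∧x≢y⇒x∈p-y (x∈p∩q⁺ (x∈p , p─q⊆p q _ x∈q-y)) (x∈p-y⇒x≢y x∈q-y)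
  back : (p ∩ q) - y ⊆ p ∩ (q - y)
  back x∈ with x∈p∩q⁻ p q (p─q⊆p _ _ x∈)
  ... | x∈p , x∈q = x∈p∩q⁺ (x∈p , x∈p∧x≢y⇒x∈p-y x∈q (x∈p-y⇒x≢y x∈))

∩-minus-∉ : ∀ {n} (p q : Subset n) {y} → y ∉ p → p ∩ (q - y) ≡ p ∩ q
∩-minus-∉ p q {y} y∉p = ⊆-antisym forth back
  where
  forth : p ∩ (q - y) ⊆ p ∩ q
  forth x∈ with x∈p∩q⁻ p (q - y) x∈
  ... | x∈p , x∈q-y = x∈p∩q⁺ (x∈p , p─q⊆p q _ x∈q-y)
  back : p ∩ q ⊆ p ∩ (q - y)
  back {x} x∈ with x∈p∩q⁻ p q x∈
  ... | x∈p , x∈q = x∈p∩q⁺ (x∈p , x∈p∧x≢y⇒x∈p-y x∈q (λ { refl → y∉p x∈p }))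

p≡⁅x⁆∪p-x : ∀ {n} (p : Subset n) {x} → x ∈ p → p ≡ ⁅ x ⁆ ∪ (p - x)
p≡⁅x⁆∪p-x p {x} x∈p = ⊆-antisym forth back
  where
  forth : p ⊆ ⁅ x ⁆ ∪ (p - x)
  forth {y} y∈p with y ≟ x
  ... | yes refl = x∈p∪q⁺ (inj₁ (x∈⁅x⁆ x))
  ... | no y≢x   = x∈p∪q⁺ (inj₂ (x∈p∧x≢y⇒x∈p-y y∈p y≢x))
  back : ⁅ x ⁆ ∪ (p - x) ⊆ p
  back y∈ with x∈p∪q⁻ ⁅ x ⁆ (p - x) y∈
  ... | inj₁ y∈⁅x⁆ rewrite x∈⁅y⁆⇒x≡y x y∈⁅x⁆ = x∈p
  ... | inj₂ y∈p-x = p─q⊆p p _ y∈p-x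

module _ {n} (G : Graph n) where

  Γ-sym : ∀ {u w} → w ∈ Γ G u → u ∈ Γ G w
  Γ-sym {u} {w} w∈ = ∈-tabulate⁺ (trans (Graph.sym G w u) (∈-tabulate⁻ w∈))

  Γ-irrefl : ∀ u → u ∉ Γ G u
  Γ-irrefl u u∈ with trans (sym (∈-tabulate⁻ u∈)) (irrefl G u)
  ... | ()

module Activation {n} (G : Graph n) (W : Subset n) (τ : Fin n → ℕ) (S : Subset n) where

  A : ℕ → Subset n
  A = Active G W τ S

  activeNeighbours : ℕ → Fin n → ℕ
  activeNeighbours ℓ u = ∣ (Γ G u ∩ W) ∩ A ℓ ∣

  stay-active : ∀ ℓ {u} → u ∈ A ℓ → u ∈ A (suc ℓ)
  stay-active ℓ {u} u∈ =
    ∈-tabulate⁺ (cong (_∨ (lookup W u ∧ (τ u ≤ᵇ activeNeighbours ℓ u))) ([]=⇒lookup u∈))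

  A-grow : ∀ d ℓ → A ℓ ⊆ A (d + ℓ)
  A-grow zero    ℓ u∈ = u∈
  A-grow (suc d) ℓ u∈ = stay-active (d + ℓ) (A-grow d ℓ u∈)

  activate : ∀ ℓ {u} → u ∈ W → τ u ≤ activeNeighbours ℓ u → u ∈ A (suc ℓ)
  activate ℓ {u} u∈W enough = ∈-tabulate⁺ (trans
    (cong₂ (λ a b → lookup (A ℓ) u ∨ (a ∧ b)) ([]=⇒lookup u∈W) (Equivalence.to T-≡ (≤⇒≤ᵇ enough)))
    (∨-zeroʳ _))

  newly-active : ∀ ℓ {u} → u ∈ A (suc ℓ) →
                 u ∈ A ℓ ⊎ (u ∈ W × τ u ≤ activeNeighbours ℓ u)
  newly-active ℓ {u} u∈ with ∈-tabulate⁻ u∈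
  ... | fires with lookup (A ℓ) u in old | lookup W u in inW
  ...   | true  | _    = inj₁ (lookup⇒[]= u _ old)
  ...   | false | true =
          inj₂ (lookup⇒[]= u _ inW , ≤ᵇ⇒≤ (τ u) _ (Equivalence.from T-≡ fires))

  A⊆W : S ⊆ W → ∀ ℓ → A ℓ ⊆ W
  A⊆W S⊆W zero    = S⊆W
  A⊆W S⊆W (suc ℓ) u∈ with newly-active ℓ u∈
  ... | inj₁ u∈A = A⊆W S⊆W ℓ u∈A
  ... | inj₂ (u∈W , _) = u∈W

  cover⇒target : S ⊆ W → ∀ ℓ → W ⊆ A ℓ → IsTarget G W τ S
  cover⇒target S⊆W ℓ W⊆A = ℓ , ⊆-antisym (A⊆W S⊆W ℓ) W⊆A

Lowered : ∀ {n} → Graph n → Subset n → Fin n → (τ τ′ : Fin n → ℕ) → Set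
Lowered G W v τ τ′ = ∀ x → x ∈ W - v → τ x ≤ τ′ x ⊎ (v ∈ Γ G x × τ x ≤ suc (τ′ x))

module Restriction {n} (G : Graph n) (W : Subset n) (v : Fin n) (v∈W : v ∈ W)
                   (τ : Fin n → ℕ) (S : Subset n) (τ′ : Fin n → ℕ) (S′ : Subset n) where
  open Activation G W τ S
  module Small = Activation G (W - v) τ′ S′

  Compensated : ℕ → Set
  Compensated c = ∀ x → x ∈ W - v → τ x ≤ τ′ x ⊎ (v ∈ A c × v ∈ Γ G x × τ x ≤ suc (τ′ x))

  module _ (c : ℕ) (S′⊆A : S′ ⊆ A c) (comp : Compensated c) where

    simulate : ∀ ℓ → Small.A ℓ ⊆ A (ℓ + c)
    simulate zero          = S′⊆A
    simulate (suc ℓ) {x} x∈ with Small.newly-active ℓ x∈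
    ... | inj₁ x∈A′ = stay-active (ℓ + c) (simulate ℓ x∈A′)
    ... | inj₂ (x∈W-v , enough) = activate (ℓ + c) (p─q⊆p W _ x∈W-v) (threshold (comp x x∈W-v))
      where
      small large : Subset n
      small = (Γ G x ∩ (W - v)) ∩ Small.A ℓ
      large = (Γ G x ∩ W) ∩ A (ℓ + c)

      small⊆large : small ⊆ large
      small⊆large y∈ with x∈p∩q⁻ (Γ G x ∩ (W - v)) _ y∈
      ... | y∈Γ-W , y∈A′ with x∈p∩q⁻ (Γ G x) (W - v) y∈Γ-W
      ...   | y∈Γ , y∈W-v = x∈p∩q⁺ (x∈p∩q⁺ (y∈Γ , p─q⊆p W _ y∈W-v) , simulate ℓ y∈A′)

      -- v itself is counted in G[W] but never in G[W - v].
      v∉small : v ∉ small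
      v∉small v∈ = y∉p-y W v (proj₂ (x∈p∩q⁻ (Γ G x) _ (proj₁ (x∈p∩q⁻ _ _ v∈))))

      threshold : τ x ≤ τ′ x ⊎ (v ∈ A c × v ∈ Γ G x × τ x ≤ suc (τ′ x)) →
                  τ x ≤ activeNeighbours (ℓ + c) x
      threshold (inj₁ τ≤τ′) = ≤-trans τ≤τ′ (≤-trans enough (p⊆q⇒∣p∣≤∣q∣ small⊆large))
      threshold (inj₂ (v∈A , v∈Γx , τ≤1+τ′)) =
        ≤-trans τ≤1+τ′ (≤-trans (s≤s enough) (p⊂q⇒∣p∣<∣q∣ (small⊆large , v , v∈large , v∉small)))
        where
        v∈large : v ∈ large
        v∈large = x∈p∩q⁺ (x∈p∩q⁺ (v∈Γx , v∈W) , A-grow ℓ c v∈A)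

    rest-active : ∀ λ′ → Small.A λ′ ≡ W - v → ∀ {x} → x ∈ W → x ≢ v → x ∈ A (λ′ + c)
    rest-active λ′ done x∈W x≢v =
      simulate λ′ (subst (_ ∈_) (sym done) (x∈p∧x≢y⇒x∈p-y x∈W x≢v))

  extend-active : ∀ c → S ⊆ W → S′ ⊆ A c → v ∈ A c → Lowered G W v τ τ′ →
                  IsTarget G (W - v) τ′ S′ → IsTarget G W τ S
  extend-active c S⊆W S′⊆A v∈A lowered (λ′ , done) = cover⇒target S⊆W (λ′ + c) cover
    where
    comp : Compensated c
    comp x x∈ = Sum.map₂ (v∈A ,_) (lowered x x∈)
    cover : W ⊆ A (λ′ + c)
    cover {x} x∈W with x ≟ v
    ... | yes refl = A-grow λ′ c v∈A
    ... | no x≢v   = rest-active c S′⊆A comp λ′ done x∈W x≢v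

  -- Case 3 of TSS: thresholds do not drop, and v can fire once all of its
  -- neighbours in G[W] are active.
  extend-last : S ⊆ W → S′ ⊆ S → (∀ x → x ∈ W - v → τ x ≤ τ′ x) →
                τ v ≤ ∣ Γ G v ∩ W ∣ → IsTarget G (W - v) τ′ S′ → IsTarget G W τ S
  extend-last S⊆W S′⊆S kept τv≤deg (λ′ , done) = cover⇒target S⊆W (suc (λ′ + 0)) cover
    where
    comp : Compensated 0
    comp x x∈ = inj₁ (kept x x∈)
    neighbours-active : Γ G v ∩ W ⊆ (Γ G v ∩ W) ∩ A (λ′ + 0)
    neighbours-active {y} y∈ with x∈p∩q⁻ (Γ G v) W y∈
    ... | y∈Γ , y∈W =
      x∈p∩q⁺ (y∈ , rest-active 0 S′⊆S comp λ′ done y∈W (λ { refl → Γ-irrefl G v y∈Γ }))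
    cover : W ⊆ A (suc (λ′ + 0))
    cover {x} x∈W with x ≟ v
    ... | yes refl = activate (λ′ + 0) v∈W (≤-trans τv≤deg (p⊆q⇒∣p∣≤∣q∣ neighbours-active))
    ... | no x≢v   = stay-active (λ′ + 0) (rest-active 0 S′⊆S comp λ′ done x∈W x≢v)

if-<ᵇ-true : ∀ {A : Set} {m n} {a b : A} → m < n → (if m <ᵇ n then a else b) ≡ a
if-<ᵇ-true m<n rewrite Equivalence.to T-≡ (<⇒<ᵇ m<n) = refl

if-<ᵇ-false : ∀ {A : Set} {m n} {a b : A} → ¬ m < n → (if m <ᵇ n then a else b) ≡ b
if-<ᵇ-false {m = m} {n} m≮n with m <ᵇ n in eq
... | false = refl
... | true  = contradiction (<ᵇ⇒< m n (Equivalence.from T-≡ eq)) m≮n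

step-removes : ∀ {n} {s s′ : State n} {v} → Step s v s′ → v ∈ U s × U s′ ≡ U s - v
step-removes (case1 v∈U _ refl)     = v∈U , refl
step-removes (case2 _ v∈U _ refl)   = v∈U , refl
step-removes (case3 _ _ v∈U _ refl) = v∈U , refl

module Bookkeeping {n} (G : Graph n) where

  record Faithful (s : State n) : Set where
    field
      nbhd   : ∀ {u} → u ∈ U s → N s u ≡ Γ G u ∩ U s
      degree : ∀ {u} → u ∈ U s → δ s u ≡ ∣ Γ G u ∩ U s ∣
  open Faithful

  initial-faithful : ∀ t → Faithful (initial G t)
  initial-faithful t = record
    { nbhd = λ {u} _ → sym (∩-identityʳ (Γ G u))
    ; degree = λ {u} _ → cong ∣_∣ (sym (∩-identityʳ (Γ G u))) }

  update-faithful : ∀ {s : State n} {v} k′ S′ → Faithful s → v ∈ U s → Faithful (update s v k′ S′)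
  update-faithful {s} {v} k′ S′ F v∈U = record { nbhd = nbhd′ ; degree = degree′ }
    where
    module _ {u} (u∈U-v : u ∈ U s - v) where
      u∈U : u ∈ U s
      u∈U = p─q⊆p (U s) _ u∈U-v

      adjacent : lookup (N s v) u ≡ true → v ∈ Γ G u ∩ U s
      adjacent e = x∈p∩q⁺ (Γ-sym G (proj₁ (x∈p∩q⁻ (Γ G v) (U s)
                     (subst (u ∈_) (nbhd F v∈U) (lookup⇒[]= u _ e)))) , v∈U)

      non-adjacent : lookup (N s v) u ≡ false → v ∉ Γ G u
      non-adjacent e v∈Γu with trans (sym e) ([]=⇒lookup
        (subst (u ∈_) (sym (nbhd F v∈U)) (x∈p∩q⁺ (Γ-sym G v∈Γu , u∈U))))
      ... | ()

      nbhd′ : (if lookup (N s v) u then N s u - v else N s u) ≡ Γ G u ∩ (U s - v)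
      nbhd′ with lookup (N s v) u in e
      ... | true  = trans (cong (_- v) (nbhd F u∈U)) (sym (∩-minus (Γ G u) (U s) v))
      ... | false = trans (nbhd F u∈U) (sym (∩-minus-∉ (Γ G u) (U s) (non-adjacent e)))

      degree′ : (if lookup (N s v) u then δ s u ∸ 1 else δ s u) ≡ ∣ Γ G u ∩ (U s - v) ∣
      degree′ with lookup (N s v) u in e
      ... | true = begin
        δ s u ∸ 1                    ≡⟨ cong (_∸ 1) (degree F u∈U) ⟩
        ∣ Γ G u ∩ U s ∣ ∸ 1          ≡⟨ cong (_∸ 1) (∣p∣≡1+∣p-x∣ _ (adjacent e)) ⟩
        ∣ (Γ G u ∩ U s) - v ∣        ≡⟨ cong ∣_∣ (sym (∩-minus (Γ G u) (U s) v)) ⟩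
        ∣ Γ G u ∩ (U s - v) ∣        ∎
        where open ≡-Reasoning
      ... | false =
        trans (degree F u∈U) (cong ∣_∣ (sym (∩-minus-∉ (Γ G u) (U s) (non-adjacent e))))

  step-faithful : ∀ {s s′ : State n} {v} → Step s v s′ → Faithful s → Faithful s′
  step-faithful (case1 v∈U _ refl)     F = update-faithful _ _ F v∈U
  step-faithful (case2 _ v∈U _ refl)   F = update-faithful _ _ F v∈U
  step-faithful (case3 _ _ v∈U _ refl) F = update-faithful _ _ F v∈U

  decK-lowered : ∀ {s : State n} {v} → Faithful s → v ∈ U s →
                 Lowered G (U s) v (k s) (decK s v)
  decK-lowered {s} {v} F v∈U x _ with lookup (N s v) x in e
  ... | false = inj₁ ≤-refl
  ... | true  = inj₂ (Γ-sym G x∈Γv , m≤n+m∸n (k s x) 1)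
    where
    x∈Γv : x ∈ Γ G v
    x∈Γv = proj₁ (x∈p∩q⁻ (Γ G v) (U s) (subst (x ∈_) (nbhd F v∈U) (lookup⇒[]= x _ e)))

  step-back : ∀ {s s′ : State n} {v} → Faithful s → Step s v s′ → ∀ {S′} → S′ ⊆ U s′ →
              IsTarget G (U s′) (k s′) S′ →
              IsTarget G (U s) (k s) (if δ s v <ᵇ k s v then S′ ∪ ⁅ v ⁆ else S′)
  step-back {s = s} {v = v} F (case1 v∈U k≡0 refl) {S′} S′⊆U′ target =
    subst (IsTarget G (U s) (k s)) (sym (if-<ᵇ-false (n≮0 ∘ subst (_ <_) k≡0)))
      (extend-active 1 S′⊆U (stay-active 0) v∈A₁ (decK-lowered F v∈U) target)
    where
    open Restriction G (U s) v v∈U (k s) S′ (decK s v) S′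
    open Activation G (U s) (k s) S′
    S′⊆U : S′ ⊆ U s
    S′⊆U x∈ = p─q⊆p (U s) _ (S′⊆U′ x∈)
    v∈A₁ : v ∈ A 1
    v∈A₁ = activate 0 v∈U (subst (_≤ activeNeighbours 0 v) (sym k≡0) z≤n)
  step-back {s = s} {v = v} F (case2 _ v∈U δ<k refl) {S′} S′⊆U′ target =
    subst (IsTarget G (U s) (k s)) (sym (if-<ᵇ-true δ<k))
      (extend-active 0 seeds⊆U (x∈p∪q⁺ ∘ inj₁) (x∈p∪q⁺ (inj₂ (x∈⁅x⁆ v)))
        (decK-lowered F v∈U) target)
    where
    open Restriction G (U s) v v∈U (k s) (S′ ∪ ⁅ v ⁆) (decK s v) S′
    seeds⊆U : S′ ∪ ⁅ v ⁆ ⊆ U s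
    seeds⊆U x∈ with x∈p∪q⁻ S′ ⁅ v ⁆ x∈
    ... | inj₁ x∈S′ = p─q⊆p (U s) _ (S′⊆U′ x∈S′)
    ... | inj₂ x∈⁅v⁆ rewrite x∈⁅y⁆⇒x≡y v x∈⁅v⁆ = v∈U
  step-back {s = s} {v = v} F (case3 _ δ≮k v∈U _ refl) {S′} S′⊆U′ target =
    subst (IsTarget G (U s) (k s)) (sym (if-<ᵇ-false (δ≮k v v∈U)))
      (extend-last (p─q⊆p (U s) _ ∘ S′⊆U′) (λ x∈ → x∈) (λ _ _ → ≤-refl) k≤deg target)
    where
    open Restriction G (U s) v v∈U (k s) S′ (k s) S′
    k≤deg : k s v ≤ ∣ Γ G v ∩ U s ∣
    k≤deg = subst (k s v ≤_) (degree F v∈U) (≮⇒≥ (δ≮k v v∈U))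

module Run {n} {G : Graph n} {t : Fin n → ℕ} (E : Execution G t) where
  open Bookkeeping G

  faithful : ∀ j → j ≤ n → Faithful (st E j)
  faithful zero    _   = subst Faithful (sym (init E)) (initial-faithful t)
  faithful (suc j) j<n = step-faithful (step E j j<n) (faithful j (<⇒≤ j<n))

  -- The iteration selecting v_{i+1} is the one just before that of v_i.
  previous : ∀ i → suc i ≤ n → suc (n ∸ suc i) ≡ n ∸ i
  previous i i<n = sym (+-∸-assoc 1 i<n)

  previous<n : ∀ i → suc i ≤ n → n ∸ suc i < n
  previous<n i i<n = subst (_≤ n) (sym (previous i i<n)) (m∸n≤m n i)

  remaining : ∀ i → i ≤ n → U (st E (n ∸ i)) ≡ Vᵢ E i
  remaining zero    _   = done E
  remaining (suc i) i<n = begin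
    U (st E j)                              ≡⟨ p≡⁅x⁆∪p-x (U (st E j)) v∈U ⟩
    ⁅ sel E j ⁆ ∪ (U (st E j) - sel E j)    ≡⟨ cong (⁅ sel E j ⁆ ∪_) (sym U′≡) ⟩
    ⁅ sel E j ⁆ ∪ U (st E (suc j))          ≡⟨ cong (λ m → ⁅ sel E j ⁆ ∪ U (st E m)) (previous i i<n) ⟩
    ⁅ sel E j ⁆ ∪ U (st E (n ∸ i))          ≡⟨ cong (⁅ sel E j ⁆ ∪_) (remaining i (<⇒≤ i<n)) ⟩
    ⁅ sel E j ⁆ ∪ Vᵢ E i                    ∎
    where
    open ≡-Reasoning
    j : ℕ
    j = n ∸ suc i
    v∈U : sel E j ∈ U (st E j)
    v∈U = proj₁ (step-removes (step E j (previous<n i i<n)))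
    U′≡ : U (st E (suc j)) ≡ U (st E j) - sel E j
    U′≡ = proj₂ (step-removes (step E j (previous<n i i<n)))

lemma2 : ∀ {n : ℕ} (G : Graph n) (t : Fin n → ℕ) (E : Execution G t) (i : ℕ) →
    1 < i → i ≤ n →
    (S′ : Subset n) → S′ ⊆ Vᵢ E (i ∸ 1) →
    IsTarget G (Vᵢ E (i ∸ 1)) (kᵢ E (i ∸ 1)) S′ →
    IsTarget G (Vᵢ E i) (kᵢ E i) (nextS E i S′)
lemma2 {n} G t E (suc m) _ m<n S′ S′⊆V target =
  subst (λ W → IsTarget G W (kᵢ E (suc m)) (nextS E (suc m) S′)) (remaining (suc m) m<n)
    (step-back (faithful j (<⇒≤ j<n)) (step E j j<n) S′⊆U′ target′)
  where
  open Run E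
  open Bookkeeping G using (step-back)
  j : ℕ
  j = n ∸ suc m
  j<n : j < n
  j<n = previous<n m m<n
  -- The state after iteration j is the one at which V_m and k_m are read.
  U′≡V : U (st E (suc j)) ≡ Vᵢ E m
  U′≡V = trans (cong (U ∘ st E) (previous m m<n)) (remaining m (<⇒≤ m<n))
  S′⊆U′ : S′ ⊆ U (st E (suc j))
  S′⊆U′ = subst (S′ ⊆_) (sym U′≡V) S′⊆V
  target′ : IsTarget G (U (st E (suc j))) (k (st E (suc j))) S′
  target′ = subst₂ (λ W τ → IsTarget G W τ S′) (sym U′≡V) (cong (k ∘ st E) (sym (previous m m<n))) target
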